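{- There is an absolute constant $c$ such that for every $n=\ell^2$ with $\ell$ a positive integer, the tilted grid sequence $S\in[n]^n$ satisfies $\mathrm{OPT}(S)\le cn$.
   Context: Tilted grid: let $\ell=\sqrt n$ and $\mathcal P=\{(i\ell+(j-1),\ j\ell+i-1): i,j\in[\ell]\}$. No two points of $\mathcal P$ share a first coordinate or a second coordinate. $S$ is the permutation of $[n]$ obtained by listing the points of $\mathcal P$ in increasing order of first coordinate (time) and recording, for each, the rank of its second coordinate (key) among all second coordinates. Dynamic BST model: an algorithm maintains a BST on $[n]$ (initial tree of its choice); to serve an access to $x$ it touches a connected subtree containing the root and $x$, and may rearrange the touched nodes into any BST; cost per access is the number of touched nodes. $\mathrm{OPT}(S)$ is the minimum total cost over all offline algorithms. -}

module Defs where

open import Data.Nat using (ℕ; zero; suc; _+_; _*_; _≤_; _≤?_)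
open import Data.Nat.Properties using (_≟_)
open import Data.List using (List; []; _∷_; _++_; map; concatMap; upTo; filter; length)
open import Data.List.Membership.Propositional using (_∈_)
open import Data.Product using (_×_; _,_; proj₁; proj₂; ∃-syntax)
open import Relation.Binary.PropositionalEquality using (_≡_)

data Tree : Set where
  leaf : Tree
  node : Tree → ℕ → Tree → Tree

inorder : Tree → List ℕ
inorder leaf         = []
inorder (node l k r) = inorder l ++ (k ∷ inorder r)

keys : ℕ → List ℕ
keys n = map suc (upTo n)

-- A BST on [n]: a binary tree whose in-order traversal is exactly 1,2,…,n
-- (i.e. the keys are [n] and the symmetric order holds).
IsBST : ℕ → Tree → Set
IsBST n t = inorder t ≡ keys n

-- A touched top part: a connected subtree containing the root, with
-- every untouched subtree hanging off it recorded at a "hole".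

data Top : Set where
  hole : Tree → Top
  node : Top → ℕ → Top → Top

fill : Top → Tree
fill (hole t)     = t
fill (node l k r) = node (fill l) k (fill r)

holes : Top → List Tree
holes (hole t)     = t ∷ []
holes (node l k r) = holes l ++ holes r

touchedKeys : Top → List ℕ
touchedKeys (hole t)     = []
touchedKeys (node l k r) = touchedKeys l ++ (k ∷ touchedKeys r)

size : Top → ℕ
size (hole t)     = 0
size (node l k r) = size l + suc (size r)

-- One access to x in the dynamic BST model: from tree t, touch a connected
-- subtree P containing the root and x, rearrange the touched nodes into a
-- new BST P' (same hanging subtrees, same symmetric order) giving tree t';
-- the cost is the number of touched nodes.
record Step (t : Tree) (x : ℕ) (t' : Tree) (cost : ℕ) : Set where
  field
    before     : Top
    after      : Top
    fillBefore : fill before ≡ t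
    fillAfter  : fill after ≡ t'
    sameHoles  : holes after ≡ holes before
    sameOrder  : inorder t' ≡ inorder t
    touchesX   : x ∈ touchedKeys before
    costIs     : cost ≡ size before

data Exec : Tree → List ℕ → ℕ → Set where
  done : ∀ {t} → Exec t [] 0
  step : ∀ {t x t' k xs c} → Step t x t' k → Exec t' xs c → Exec t (x ∷ xs) (k + c)

OPT≤ : ℕ → List ℕ → ℕ → Set
OPT≤ n S b = ∃[ t₀ ] (IsBST n t₀ × ∃[ c ] (Exec t₀ S c × c ≤ b))

-- Points (iℓ + (j-1), jℓ + i - 1) for i, j ∈ [ℓ]; written with
-- i = suc i', j = suc j', i', j' ∈ {0,…,ℓ-1}.
tiltedPoints : ℕ → List (ℕ × ℕ)
tiltedPoints ℓ =
  concatMap (λ i' → map (λ j' → (suc i' * ℓ + j' , suc j' * ℓ + i')) (upTo ℓ)) (upTo ℓ)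

-- rank of y among the list ys (1-based: number of elements ≤ y)
rank : List ℕ → ℕ → ℕ
rank ys y = length (filter (_≤? y) ys)

-- Points listed in increasing order of first coordinate (all first
-- coordinates lie in {0,…,ℓ²+ℓ-1} and are distinct).
sortedByTime : ℕ → List (ℕ × ℕ)
sortedByTime ℓ =
  concatMap (λ t → filter (λ p → proj₁ p ≟ t) (tiltedPoints ℓ)) (upTo (ℓ * ℓ + ℓ))

tiltedGrid : ℕ → List ℕ
tiltedGrid ℓ = map (λ p → rank (map proj₂ (tiltedPoints ℓ)) (proj₂ p)) (sortedByTime ℓ)

-- Split the key set [ℓ²] into ℓ blocks of ℓ consecutive keys.  Sorted by
-- time, the tilted grid is read round by round: round r accesses the r-th key
-- of every block, in increasing order of keys.  An offline algorithm keeps the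
-- keys of the current round on a right path, the rest of block k (together
-- with the keys of block k + 1 accessed so far) forming the left subtree of the
-- key of block k + 1.  Every access but the last of a round is one rotation
-- (cost 2), after which the accessed keys form a left path; the last access
-- touches that path and the top of every block (at most 3 nodes per block) and
-- rebuilds the right path of the next round.  A round thus costs at most 5ℓ,
-- and the ℓ rounds cost at most 5ℓ².
module Submission where

open import Defs
open import Data.Nat using (ℕ; zero; suc; _+_; _*_; _≤_; _<_; _≤?_; z≤n; s≤s; z<s; s<s)
open import Data.Nat.Properties
open import Data.Nat.Solver using (module +-*-Solver)
open import Data.Product using (_×_; _,_; proj₁; proj₂; ∃-syntax)
open import Data.Sum using (_⊎_; inj₁; inj₂)
open import Data.Maybe using (Maybe; just; nothing)
open import Data.List using (List; []; _∷_; _++_; map; concat; concatMap; filter; length; applyUpTo; upTo)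
open import Data.List.Properties
  using (++-assoc; ++-identityʳ; ∷-injective; concatMap-++; map-concatMap; map-∘; map-id; map-applyUpTo;
         length-map; length-++; length-applyUpTo; filter-accept; filter-reject; filter-++)
open import Data.List.Membership.Propositional using (_∈_)
open import Data.List.Membership.Propositional.Properties using (∈-++⁺ʳ)
open import Data.List.Relation.Unary.Any using (here)
open import Data.Empty using (⊥-elim)
open import Function using (_∘_)
open import Relation.Binary.PropositionalEquality
open import Relation.Unary using (Decidable)

applyUpTo-cong : ∀ {A : Set} {f g : ℕ → A} n → (∀ i → i < n → f i ≡ g i) → applyUpTo f n ≡ applyUpTo g n
applyUpTo-cong zero    f≡g = refl
applyUpTo-cong (suc n) f≡g = cong₂ _∷_ (f≡g 0 z<s) (applyUpTo-cong n (λ i i<n → f≡g (suc i) (s<s i<n)))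

applyUpTo-+ : ∀ {A : Set} (f : ℕ → A) m n → applyUpTo f (m + n) ≡ applyUpTo f m ++ applyUpTo (λ i → f (m + i)) n
applyUpTo-+ f zero    n = refl
applyUpTo-+ f (suc m) n = cong (f 0 ∷_) (applyUpTo-+ (f ∘ suc) m n)

applyUpTo-* : ∀ {A : Set} (f : ℕ → A) ℓ a →
              applyUpTo f (a * ℓ) ≡ concat (applyUpTo (λ k → applyUpTo (λ r → f (k * ℓ + r)) ℓ) a)
applyUpTo-* f ℓ zero    = refl
applyUpTo-* f ℓ (suc a) = begin
  applyUpTo f (ℓ + a * ℓ)
    ≡⟨ applyUpTo-+ f ℓ (a * ℓ) ⟩
  applyUpTo f ℓ ++ applyUpTo (λ i → f (ℓ + i)) (a * ℓ)
    ≡⟨ cong (applyUpTo f ℓ ++_) (applyUpTo-* (λ i → f (ℓ + i)) ℓ a) ⟩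
  applyUpTo f ℓ ++ concat (applyUpTo (λ k → applyUpTo (λ r → f (ℓ + (k * ℓ + r))) ℓ) a)
    ≡⟨ cong (λ xss → applyUpTo f ℓ ++ concat xss)
            (applyUpTo-cong a (λ k _ → applyUpTo-cong ℓ (λ r _ → cong f (sym (+-assoc ℓ (k * ℓ) r))))) ⟩
  applyUpTo f ℓ ++ concat (applyUpTo (λ k → applyUpTo (λ r → f (suc k * ℓ + r)) ℓ) a)
    ∎
  where open ≡-Reasoning

concat-applyUpTo-[] : ∀ {A : Set} {f : ℕ → List A} n → (∀ i → i < n → f i ≡ []) → concat (applyUpTo f n) ≡ []
concat-applyUpTo-[] zero    f≡[] = refl
concat-applyUpTo-[] (suc n) f≡[] =
  cong₂ _++_ (f≡[] 0 z<s) (concat-applyUpTo-[] n (λ i i<n → f≡[] (suc i) (s<s i<n)))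

module Counting {A : Set} {P : A → Set} (P? : Decidable P) where

  count : List A → ℕ
  count xs = length (filter P? xs)

  count-++ : ∀ xs ys → count (xs ++ ys) ≡ count xs + count ys
  count-++ xs ys = trans (cong length (filter-++ P? xs ys)) (length-++ (filter P? xs))

  count-applyUpTo : ∀ n m (h : ℕ → A) → m ≤ n →
                    (∀ i → i < n → P (h i) → i < m) → (∀ i → i < m → P (h i)) →
                    count (applyUpTo h n) ≡ m
  count-applyUpTo zero    m       h m≤0       _    _ = sym (n≤0⇒n≡0 m≤0)
  count-applyUpTo (suc n) zero    h _         only _ =
    trans (cong length (filter-reject P? (n≮0 ∘ only 0 z<s)))
          (count-applyUpTo n zero (h ∘ suc) z≤n (λ i i<n Ph → ⊥-elim (n≮0 (only (suc i) (s<s i<n) Ph))) (λ _ ()))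
  count-applyUpTo (suc n) (suc m) h (s≤s m≤n) only prefix =
    trans (cong length (filter-accept P? (prefix 0 z<s)))
          (cong suc (count-applyUpTo n m (h ∘ suc) m≤n
                       (λ i i<n Ph → ≤-pred (only (suc i) (s<s i<n) Ph))
                       (λ i i<m → prefix (suc i) (s<s i<m))))

  count-concat-applyUpTo : ∀ j n m (G : ℕ → List A) → m ≤ n →
                           (∀ k → k < m → count (G k) ≡ suc j) → (∀ k → m ≤ k → k < n → count (G k) ≡ j) →
                           count (concat (applyUpTo G n)) ≡ m + n * j
  count-concat-applyUpTo j zero    m       G m≤0       _     _     = sym (trans (+-identityʳ m) (n≤0⇒n≡0 m≤0))
  count-concat-applyUpTo j (suc n) zero    G _         _     later =
    trans (count-++ (G 0) _)
          (cong₂ _+_ (later 0 z≤n z<s)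
                     (count-concat-applyUpTo j n zero (G ∘ suc) z≤n (λ _ ()) (λ k _ k<n → later (suc k) z≤n (s<s k<n))))
  count-concat-applyUpTo j (suc n) (suc m) G (s≤s m≤n) early later =
    trans (count-++ (G 0) _)
          (trans (cong₂ _+_ (early 0 z<s)
                            (count-concat-applyUpTo j n m (G ∘ suc) m≤n (λ k k<m → early (suc k) (s<s k<m))
                                                    (λ k m≤k k<n → later (suc k) (s<s m≤k) (s<s k<n))))
                 (cong suc (+-left-comm j m (n * j))))
    where
    open +-*-Solver
    +-left-comm : ∀ a b c → a + (b + c) ≡ b + (a + c)
    +-left-comm = solve 3 (λ a b c → a :+ (b :+ c) := b :+ (a :+ c)) refl

blockKey : ℕ → ℕ → ℕ → ℕ
blockKey ℓ k r = suc (k * ℓ + r)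

map-tiltedPoints : ∀ {A : Set} ℓ (g : ℕ × ℕ → A) →
                   map g (tiltedPoints ℓ)
                     ≡ concat (applyUpTo (λ a → applyUpTo (λ b → g (suc a * ℓ + b , suc b * ℓ + a)) ℓ) ℓ)
map-tiltedPoints ℓ g = begin
  map g (concatMap row (upTo ℓ))         ≡⟨ map-concatMap g row (upTo ℓ) ⟩
  concat (map (map g ∘ row) (upTo ℓ))    ≡⟨ cong concat (map-applyUpTo (λ a → a) (map g ∘ row) ℓ) ⟩
  concat (applyUpTo (map g ∘ row) ℓ)
    ≡⟨ cong concat (applyUpTo-cong ℓ (λ a _ → trans (sym (map-∘ (upTo ℓ))) (map-applyUpTo (λ b → b) _ ℓ))) ⟩
  concat (applyUpTo (λ a → applyUpTo (λ b → g (suc a * ℓ + b , suc b * ℓ + a)) ℓ) ℓ) ∎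
  where
  open ≡-Reasoning
  row : ℕ → List (ℕ × ℕ)
  row a = map (λ b → (suc a * ℓ + b , suc b * ℓ + a)) (upTo ℓ)

times-tiltedPoints : ∀ ℓ → map proj₁ (tiltedPoints ℓ) ≡ applyUpTo (ℓ +_) (ℓ * ℓ)
times-tiltedPoints ℓ = begin
  map proj₁ (tiltedPoints ℓ)
    ≡⟨ map-tiltedPoints ℓ proj₁ ⟩
  concat (applyUpTo (λ a → applyUpTo (λ b → suc a * ℓ + b) ℓ) ℓ)
    ≡⟨ cong concat (applyUpTo-cong ℓ (λ a _ → applyUpTo-cong ℓ (λ b _ → +-assoc ℓ (a * ℓ) b))) ⟩
  concat (applyUpTo (λ a → applyUpTo (λ b → ℓ + (a * ℓ + b)) ℓ) ℓ)
    ≡⟨ applyUpTo-* (ℓ +_) ℓ ℓ ⟨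
  applyUpTo (ℓ +_) (ℓ * ℓ) ∎
  where open ≡-Reasoning

-- Keys are compared like two-digit numerals in base ℓ.
m*ℓ+a<n*ℓ : ∀ {ℓ m n a} → a < ℓ → m < n → m * ℓ + a < n * ℓ
m*ℓ+a<n*ℓ {ℓ} {m} {n} {a} a<ℓ m<n = begin-strict
  m * ℓ + a  <⟨ +-monoʳ-< (m * ℓ) a<ℓ ⟩
  m * ℓ + ℓ  ≡⟨ +-comm (m * ℓ) ℓ ⟩
  suc m * ℓ  ≤⟨ *-monoˡ-≤ ℓ m<n ⟩
  n * ℓ      ∎
  where open ≤-Reasoning

m*ℓ+a≤n*ℓ+b⇒m≤n : ∀ {ℓ m n a b} → b < ℓ → m * ℓ + a ≤ n * ℓ + b → m ≤ n
m*ℓ+a≤n*ℓ+b⇒m≤n {ℓ} {m} {n} {a} {b} b<ℓ le =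
  ≤-pred (*-cancelʳ-< ℓ m (suc n)
    (≤-<-trans (m≤m+n (m * ℓ) a) (≤-<-trans le (m*ℓ+a<n*ℓ {m = n} b<ℓ ≤-refl))))

rank-tiltedPoints : ∀ ℓ i j → i < ℓ → j < ℓ →
                    rank (map proj₂ (tiltedPoints ℓ)) (suc j * ℓ + i) ≡ blockKey ℓ j i
rank-tiltedPoints ℓ i j i<ℓ j<ℓ =
  trans (cong count (map-tiltedPoints ℓ proj₂))
        (trans (count-concat-applyUpTo j ℓ (suc i) row i<ℓ (λ a → rowUpTo a ∘ ≤-pred) rowAbove)
               (cong suc (trans (+-comm i (ℓ * j)) (cong (_+ i) (*-comm ℓ j)))))
  where
  y : ℕ
  y = suc j * ℓ + i
  open Counting (_≤? y)
  row : ℕ → List ℕ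
  row a = applyUpTo (λ b → suc b * ℓ + a) ℓ
  rowUpTo : ∀ a → a ≤ i → count (row a) ≡ suc j
  rowUpTo a a≤i = count-applyUpTo ℓ (suc j) _ j<ℓ (λ b _ → m*ℓ+a≤n*ℓ+b⇒m≤n i<ℓ)
                                  (λ b b<sj → +-mono-≤ (*-monoˡ-≤ ℓ b<sj) a≤i)
  rowAbove : ∀ a → suc i ≤ a → a < ℓ → count (row a) ≡ j
  rowAbove a i<a a<ℓ = count-applyUpTo ℓ j _ (<⇒≤ j<ℓ) only
                                       (λ b b<j → ≤-trans (<⇒≤ (m*ℓ+a<n*ℓ a<ℓ (s<s b<j))) (m≤m+n _ i))
    where
    only : ∀ b → b < ℓ → suc b * ℓ + a ≤ y → b < j
    only b _ ≤y = ≤-pred (*-cancelʳ-< ℓ (suc b) (suc j)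
                           (+-cancelʳ-< a (suc b * ℓ) (suc j * ℓ) (≤-<-trans ≤y (+-monoʳ-< (suc j * ℓ) i<a))))

select : ∀ {A : Set} → List (ℕ × A) → ℕ → List (ℕ × A)
select L t = filter (λ p → proj₁ p ≟ t) L

select-absent : ∀ {A : Set} (L : List (ℕ × A)) (h : ℕ → ℕ) N t →
                map proj₁ L ≡ applyUpTo h N → (∀ i → h i ≢ t) → select L t ≡ []
select-absent []      h N       t _  _   = refl
select-absent (p ∷ L) h zero    t () _
select-absent (p ∷ L) h (suc N) t eq h≢t with ∷-injective eq
... | p≡h0 , rest = trans (filter-reject (λ q → proj₁ q ≟ t) (h≢t 0 ∘ trans (sym p≡h0)))
                          (select-absent L (h ∘ suc) N t rest (h≢t ∘ suc))

concatMap-select-increasing : ∀ {A : Set} (L : List (ℕ × A)) N (h : ℕ → ℕ) →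
                              (∀ {i j} → i < j → h i < h j) → map proj₁ L ≡ applyUpTo h N →
                              concatMap (select L) (applyUpTo h N) ≡ L
concatMap-select-increasing []      zero    h h-mono _  = refl
concatMap-select-increasing (p ∷ L) (suc N) h h-mono eq with ∷-injective eq
... | p≡h0 , rest =
  cong₂ _++_ selectFirst (trans selectLater (concatMap-select-increasing L N (h ∘ suc) (h-mono ∘ s<s) rest))
  where
  later≢first : ∀ i → h (suc i) ≢ h 0
  later≢first i e = <-irrefl (sym e) (h-mono z<s)
  selectFirst : select (p ∷ L) (h 0) ≡ p ∷ []
  selectFirst = trans (filter-accept (λ q → proj₁ q ≟ h 0) p≡h0)
                      (cong (p ∷_) (select-absent L (h ∘ suc) N (h 0) rest later≢first))
  selectLater : concatMap (select (p ∷ L)) (applyUpTo (h ∘ suc) N) ≡ concatMap (select L) (applyUpTo (h ∘ suc) N)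
  selectLater = cong concat (trans (map-applyUpTo (h ∘ suc) _ N) (trans
    (applyUpTo-cong N (λ i _ →
      filter-reject (λ q → proj₁ q ≟ h (suc i)) (λ e → later≢first i (trans (sym e) p≡h0))))
    (sym (map-applyUpTo (h ∘ suc) _ N))))

sortedByTime-tiltedPoints : ∀ ℓ → sortedByTime ℓ ≡ tiltedPoints ℓ
sortedByTime-tiltedPoints ℓ = begin
  concatMap (select T) (upTo (ℓ * ℓ + ℓ))
    ≡⟨ cong (concatMap (select T) ∘ upTo) (+-comm (ℓ * ℓ) ℓ) ⟩
  concatMap (select T) (upTo (ℓ + ℓ * ℓ))
    ≡⟨ cong (concatMap (select T)) (applyUpTo-+ (λ t → t) ℓ (ℓ * ℓ)) ⟩
  concatMap (select T) (upTo ℓ ++ applyUpTo (ℓ +_) (ℓ * ℓ))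
    ≡⟨ concatMap-++ (select T) (upTo ℓ) _ ⟩
  concatMap (select T) (upTo ℓ) ++ concatMap (select T) (applyUpTo (ℓ +_) (ℓ * ℓ))
    ≡⟨ cong₂ _++_ early
                  (concatMap-select-increasing T (ℓ * ℓ) (ℓ +_) (+-monoʳ-< ℓ) (times-tiltedPoints ℓ)) ⟩
  T ∎
  where
  open ≡-Reasoning
  T = tiltedPoints ℓ
  early : concatMap (select T) (upTo ℓ) ≡ []
  early = trans (cong concat (map-applyUpTo (λ t → t) (select T) ℓ)) (concat-applyUpTo-[] ℓ (λ t t<ℓ →
            select-absent T (ℓ +_) (ℓ * ℓ) t (times-tiltedPoints ℓ)
                          (λ i e → <⇒≱ t<ℓ (subst (ℓ ≤_) e (m≤m+n ℓ i)))))

tiltedGrid-byRounds : ∀ ℓ → tiltedGrid ℓ ≡ concat (applyUpTo (λ r → applyUpTo (λ k → blockKey ℓ k r) ℓ) ℓ)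
tiltedGrid-byRounds ℓ = begin
  map keyRank (sortedByTime ℓ)
    ≡⟨ cong (map keyRank) (sortedByTime-tiltedPoints ℓ) ⟩
  map keyRank (tiltedPoints ℓ)
    ≡⟨ map-tiltedPoints ℓ keyRank ⟩
  concat (applyUpTo (λ a → applyUpTo (λ b → rank (map proj₂ (tiltedPoints ℓ)) (suc b * ℓ + a)) ℓ) ℓ)
    ≡⟨ cong concat (applyUpTo-cong ℓ (λ a a<ℓ →
                      applyUpTo-cong ℓ (λ b b<ℓ → rank-tiltedPoints ℓ a b a<ℓ b<ℓ))) ⟩
  concat (applyUpTo (λ r → applyUpTo (λ k → blockKey ℓ k r) ℓ) ℓ) ∎
  where
  open ≡-Reasoning
  keyRank : ℕ × ℕ → ℕ
  keyRank p = rank (map proj₂ (tiltedPoints ℓ)) (proj₂ p)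

roundRobin : ℕ → List (ℕ → ℕ) → List ℕ
roundRobin zero    cs = []
roundRobin (suc M) cs = map (λ c → c 0) cs ++ roundRobin M (map (λ c → c ∘ suc) cs)

roundRobin-applyUpTo : ∀ M cs → roundRobin M cs ≡ concat (applyUpTo (λ r → map (λ c → c r) cs) M)
roundRobin-applyUpTo zero    cs = refl
roundRobin-applyUpTo (suc M) cs = cong (map (λ c → c 0) cs ++_)
  (trans (roundRobin-applyUpTo M (map (λ c → c ∘ suc) cs))
         (cong concat (applyUpTo-cong M (λ r _ → sym (map-∘ cs)))))

roundRobin-blockKey : ∀ ℓ → roundRobin ℓ (applyUpTo (blockKey ℓ) ℓ) ≡ tiltedGrid ℓ
roundRobin-blockKey ℓ =
  trans (roundRobin-applyUpTo ℓ (applyUpTo (blockKey ℓ) ℓ))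
        (trans (cong concat (applyUpTo-cong ℓ (λ r _ → map-applyUpTo (blockKey ℓ) (λ c → c r) ℓ)))
               (sym (tiltedGrid-byRounds ℓ)))

frontier : Top → List (Tree ⊎ ℕ)
frontier (hole t)     = inj₁ t ∷ []
frontier (node l k r) = frontier l ++ inj₂ k ∷ frontier r

trees : List (Tree ⊎ ℕ) → List Tree
trees []            = []
trees (inj₁ t ∷ xs) = t ∷ trees xs
trees (inj₂ _ ∷ xs) = trees xs

flatten : List (Tree ⊎ ℕ) → List ℕ
flatten []            = []
flatten (inj₁ t ∷ xs) = inorder t ++ flatten xs
flatten (inj₂ k ∷ xs) = k ∷ flatten xs

trees-++ : ∀ xs ys → trees (xs ++ ys) ≡ trees xs ++ trees ys
trees-++ []            ys = refl
trees-++ (inj₁ t ∷ xs) ys = cong (t ∷_) (trees-++ xs ys)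
trees-++ (inj₂ _ ∷ xs) ys = trees-++ xs ys

flatten-++ : ∀ xs ys → flatten (xs ++ ys) ≡ flatten xs ++ flatten ys
flatten-++ []            ys = refl
flatten-++ (inj₁ t ∷ xs) ys = trans (cong (inorder t ++_) (flatten-++ xs ys)) (sym (++-assoc (inorder t) _ _))
flatten-++ (inj₂ k ∷ xs) ys = cong (k ∷_) (flatten-++ xs ys)

holes-frontier : ∀ P → holes P ≡ trees (frontier P)
holes-frontier (hole t)     = refl
holes-frontier (node l k r) =
  trans (cong₂ _++_ (holes-frontier l) (holes-frontier r))
        (sym (trees-++ (frontier l) (inj₂ k ∷ frontier r)))

inorder-fill : ∀ P → inorder (fill P) ≡ flatten (frontier P)
inorder-fill (hole t)     = sym (++-identityʳ (inorder t))
inorder-fill (node l k r) =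
  trans (cong₂ (λ xs ys → xs ++ k ∷ ys) (inorder-fill l) (inorder-fill r))
        (sym (flatten-++ (frontier l) (inj₂ k ∷ frontier r)))

rearrange : ∀ {t x t′} (B A : Top) → fill B ≡ t → fill A ≡ t′ → frontier B ≡ frontier A → x ∈ touchedKeys B →
            Step t x t′ (size B)
rearrange {t} {x} {t′} B A fillB fillA B≈A x∈B = record
  { before = B ; after = A ; fillBefore = fillB ; fillAfter = fillA
  ; sameHoles = begin
      holes A                ≡⟨ holes-frontier A ⟩
      trees (frontier A)     ≡⟨ cong trees B≈A ⟨
      trees (frontier B)     ≡⟨ holes-frontier B ⟨
      holes B                ∎
  ; sameOrder = begin
      inorder t′             ≡⟨ cong inorder fillA ⟨
      inorder (fill A)       ≡⟨ inorder-fill A ⟩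
      flatten (frontier A)   ≡⟨ cong flatten B≈A ⟨
      flatten (frontier B)   ≡⟨ inorder-fill B ⟨
      inorder (fill B)       ≡⟨ cong inorder fillB ⟩
      inorder t              ∎
  ; touchesX = x∈B ; costIs = refl }
  where open ≡-Reasoning

rotateLeft : ∀ L x G y R → Step (node L x (node G y R)) x (node (node L x G) y R) 2
rotateLeft L x G y R =
  rearrange (node (hole L) x (node (hole G) y (hole R))) (node (node (hole L) x (hole G)) y (hole R))
            refl refl refl (here refl)

accessRoot : ∀ L x R → Step (node L x R) x (node L x R) 1
accessRoot L x R = rearrange (node (hole L) x (hole R)) (node (hole L) x (hole R)) refl refl refl (here refl)

Serves : Tree → List ℕ → ℕ → Set
Serves t xs b = ∃[ c ] (Exec t xs c × c ≤ b)

serves-[] : ∀ {t} → Serves t [] 0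
serves-[] = 0 , done , z≤n

serves-step : ∀ {t x t′ k xs b} → Step t x t′ k → Serves t′ xs b → Serves t (x ∷ xs) (k + b)
serves-step {k = k} st (c , e , c≤b) = k + c , step st e , +-monoʳ-≤ k c≤b

serves-mono : ∀ {t xs b b′} → b ≤ b′ → Serves t xs b → Serves t xs b′
serves-mono b≤b′ (c , e , c≤b) = c , e , ≤-trans c≤b b≤b′

-- The state of one block at the start of a round: keysFrom r is its key
-- accessed r rounds later, and gap stores the keys of the following block
-- accessed so far, which lie between the two blocks in symmetric order.
-- Below, M is the number of rounds still to come after the current one.
record Block : Set where
  constructor block
  field
    keysFrom : ℕ → ℕ
    gap      : Maybe (ℕ × Tree)
open Block

current next : Block → ℕ
current b = keysFrom b 0
next    b = keysFrom b 1

rightPath : (ℕ → ℕ) → ℕ → Tree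
rightPath h zero    = leaf
rightPath h (suc m) = node leaf (h 0) (rightPath (h ∘ suc) m)

withGap : Tree → Maybe (ℕ × Tree) → Tree
withGap T nothing        = T
withGap T (just (z , W)) = node T z W

remainder : ℕ → Block → Tree
remainder M b = withGap (rightPath (keysFrom b ∘ suc) M) (gap b)

chain : Tree → List (ℕ × Tree) → Tree
chain G []             = G
chain G ((y , H) ∷ ps) = node G y (chain H ps)

links : ℕ → List Block → List (ℕ × Tree)
links M = map (λ b → current b , remainder M b)

roundStart : ℕ → Tree → Block → List Block → Tree
roundStart M D b bs = node D (current b) (chain (remainder M b) (links M bs))

roundEnd : ℕ → Tree → Block → List Block → Tree
roundEnd M L b []        = node L (current b) (remainder M b)
roundEnd M L b (b′ ∷ bs) = roundEnd M (node L (current b) (remainder M b)) b′ bs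

lastKey : Block → List Block → ℕ
lastKey b []        = current b
lastKey b (b′ ∷ bs) = lastKey b′ bs

serves-rotations : ∀ M L b bs {xs c} → Serves (roundEnd M L b bs) (lastKey b bs ∷ xs) c →
                   Serves (roundStart M L b bs) (map current (b ∷ bs) ++ xs) (length bs * 2 + c)
serves-rotations M L b []        s = s
serves-rotations M L b (b′ ∷ bs) {c = c} s =
  serves-mono (≤-reflexive (sym (+-assoc 2 (length bs * 2) c)))
    (serves-step (rotateLeft L (current b) (remainder M b) (current b′) _)
                 (serves-rotations M (node L (current b) (remainder M b)) b′ bs s))

serves-lastKey : ∀ M L b bs → Serves (roundEnd M L b bs) (lastKey b bs ∷ []) 1
serves-lastKey M L b []        = serves-step (accessRoot L (current b) (remainder M b)) serves-[]
serves-lastKey M L b (b′ ∷ bs) = serves-lastKey M (node L (current b) (remainder M b)) b′ bs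

extendGap : Maybe (ℕ × Tree) → ℕ → Maybe (ℕ × Tree)
extendGap nothing        y = just (y , leaf)
extendGap (just (z , W)) y = just (z , node W y leaf)

gapAfter : Block → List Block → Maybe (ℕ × Tree)
gapAfter b []       = gap b
gapAfter b (b′ ∷ _) = extendGap (gap b) (current b′)

advance : Block → List Block → Block
advance b bs = block (keysFrom b ∘ suc) (gapAfter b bs)

shift : List Block → List Block
shift []       = []
shift (b ∷ bs) = advance b bs ∷ shift bs

length-shift : ∀ bs → length (shift bs) ≡ length bs
length-shift []       = refl
length-shift (b ∷ bs) = cong suc (length-shift bs)

map-keysFrom-shift : ∀ bs → map keysFrom (shift bs) ≡ map (λ c → c ∘ suc) (map keysFrom bs)
map-keysFrom-shift []       = refl
map-keysFrom-shift (b ∷ bs) = cong (keysFrom b ∘ suc ∷_) (map-keysFrom-shift bs)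

-- The last access of a round touches gather: the left path of the round's keys
-- and, in every block, its next key and the root of its gap.  These are
-- rearranged into spread, the right path of the next round's keys, each
-- accessed key being appended to the gap of the preceding block.
grabNext : ℕ → Block → Top
grabNext M (block c nothing)        = node (hole leaf) (c 1) (hole (rightPath (c ∘ suc ∘ suc) M))
grabNext M (block c (just (z , W))) =
  node (node (hole leaf) (c 1) (hole (rightPath (c ∘ suc ∘ suc) M))) z (hole W)

gather : ℕ → Top → Block → List Block → Top
gather M A b []        = node A (current b) (grabNext M b)
gather M A b (b′ ∷ bs) = gather M (node A (current b) (grabNext M b)) b′ bs

newRemainder : ℕ → Block → List Block → Top
newRemainder M (block c nothing)        []       = hole (rightPath (c ∘ suc ∘ suc) M)
newRemainder M (block c (just (z , W))) []       = node (hole (rightPath (c ∘ suc ∘ suc) M)) z (hole W)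
newRemainder M (block c nothing)        (b′ ∷ _) =
  node (hole (rightPath (c ∘ suc ∘ suc) M)) (current b′) (hole leaf)
newRemainder M (block c (just (z , W))) (b′ ∷ _) =
  node (hole (rightPath (c ∘ suc ∘ suc) M)) z (node (hole W) (current b′) (hole leaf))

spread : ℕ → Block → List Block → Top
spread M b []        = newRemainder M b []
spread M b (b′ ∷ bs) = node (newRemainder M b (b′ ∷ bs)) (next b′) (spread M b′ bs)

fill-grabNext : ∀ M b → fill (grabNext M b) ≡ remainder (suc M) b
fill-grabNext M (block c nothing)        = refl
fill-grabNext M (block c (just (z , W))) = refl

fill-gather : ∀ M A b bs → fill (gather M A b bs) ≡ roundEnd (suc M) (fill A) b bs
fill-gather M A b []        = cong (node (fill A) (current b)) (fill-grabNext M b)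
fill-gather M A b (b′ ∷ bs) =
  trans (fill-gather M (node A (current b) (grabNext M b)) b′ bs)
        (cong (λ T → roundEnd (suc M) (node (fill A) (current b) T) b′ bs) (fill-grabNext M b))

fill-newRemainder : ∀ M b bs → fill (newRemainder M b bs) ≡ remainder M (advance b bs)
fill-newRemainder M (block c nothing)        []       = refl
fill-newRemainder M (block c (just (z , W))) []       = refl
fill-newRemainder M (block c nothing)        (b′ ∷ _) = refl
fill-newRemainder M (block c (just (z , W))) (b′ ∷ _) = refl

fill-spread : ∀ M b bs → fill (spread M b bs) ≡ chain (remainder M (advance b bs)) (links M (shift bs))
fill-spread M b []        = fill-newRemainder M b []
fill-spread M b (b′ ∷ bs) =
  cong₂ (λ G T → node G (next b′) T) (fill-newRemainder M b (b′ ∷ bs)) (fill-spread M b′ bs)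

frontier-grabNext-last : ∀ M b →
                         frontier (grabNext M b) ≡ inj₁ leaf ∷ inj₂ (next b) ∷ frontier (newRemainder M b [])
frontier-grabNext-last M (block c nothing)        = refl
frontier-grabNext-last M (block c (just (z , W))) = refl

frontier-grabNext : ∀ M b b′ bs R →
                    frontier (grabNext M b) ++ inj₂ (current b′) ∷ inj₁ leaf ∷ R
                      ≡ inj₁ leaf ∷ inj₂ (next b) ∷ (frontier (newRemainder M b (b′ ∷ bs)) ++ R)
frontier-grabNext M (block c nothing)        b′ bs R = refl
frontier-grabNext M (block c (just (z , W))) b′ bs R = refl

frontier-gather : ∀ M A b bs →
                  frontier (gather M A b bs)
                    ≡ frontier A ++ inj₂ (current b) ∷ inj₁ leaf ∷ inj₂ (next b) ∷ frontier (spread M b bs)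
frontier-gather M A b []        = cong (λ F → frontier A ++ inj₂ (current b) ∷ F) (frontier-grabNext-last M b)
frontier-gather M A b (b′ ∷ bs) = begin
  frontier (gather M A′ b′ bs)
    ≡⟨ frontier-gather M A′ b′ bs ⟩
  (frontier A ++ inj₂ (current b) ∷ frontier (grabNext M b)) ++ inj₂ (current b′) ∷ inj₁ leaf ∷ R
    ≡⟨ ++-assoc (frontier A) _ _ ⟩
  frontier A ++ inj₂ (current b) ∷ (frontier (grabNext M b) ++ inj₂ (current b′) ∷ inj₁ leaf ∷ R)
    ≡⟨ cong (λ F → frontier A ++ inj₂ (current b) ∷ F) (frontier-grabNext M b b′ bs R) ⟩
  frontier A ++ inj₂ (current b) ∷ inj₁ leaf ∷ inj₂ (next b) ∷ frontier (spread M b (b′ ∷ bs)) ∎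
  where
  open ≡-Reasoning
  A′ = node A (current b) (grabNext M b)
  R  = inj₂ (next b′) ∷ frontier (spread M b′ bs)

lastKey∈gather : ∀ M A b bs → lastKey b bs ∈ touchedKeys (gather M A b bs)
lastKey∈gather M A b []        = ∈-++⁺ʳ (touchedKeys A) (here refl)
lastKey∈gather M A b (b′ ∷ bs) = lastKey∈gather M (node A (current b) (grabNext M b)) b′ bs

size-grabNext : ∀ M b → size (grabNext M b) ≤ 2
size-grabNext M (block c nothing)        = s≤s z≤n
size-grabNext M (block c (just (z , W))) = s≤s (s≤s z≤n)

size-gather : ∀ M A b bs → size (gather M A b bs) ≤ size A + suc (length bs) * 3
size-gather M A b []        = +-monoʳ-≤ (size A) (s≤s (size-grabNext M b))
size-gather M A b (b′ ∷ bs) =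
  ≤-trans (size-gather M (node A (current b) (grabNext M b)) b′ bs)
          (≤-trans (+-monoˡ-≤ (suc (length bs) * 3) (+-monoʳ-≤ (size A) (s≤s (size-grabNext M b))))
                   (≤-reflexive (+-assoc (size A) 3 (suc (length bs) * 3))))

transition : ∀ M D b bs →
             Step (roundEnd (suc M) D b bs) (lastKey b bs)
                  (roundStart M (node D (current b) leaf) (advance b bs) (shift bs))
                  (size (gather M (hole D) b bs))
transition M D b bs =
  rearrange (gather M (hole D) b bs) (node (node (hole D) (current b) (hole leaf)) (next b) (spread M b bs))
            (fill-gather M (hole D) b bs) (cong (node (node D (current b) leaf) (next b)) (fill-spread M b bs))
            (frontier-gather M (hole D) b bs) (lastKey∈gather M (hole D) b bs)

serves-transition : ∀ M D b bs {xs c} →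
                    Serves (roundStart M (node D (current b) leaf) (advance b bs) (shift bs)) xs c →
                    Serves (roundEnd (suc M) D b bs) (lastKey b bs ∷ xs) (suc (length bs) * 3 + c)
serves-transition M D b bs s =
  serves-mono (+-monoˡ-≤ _ (size-gather M (hole D) b bs)) (serves-step (transition M D b bs) s)

round-cost : ∀ n R → n * 2 + (suc n * 3 + R) ≤ suc n * 5 + R
round-cost n R = ≤-trans (m≤m+n _ 2) (≤-reflexive (slack n R))
  where
  open +-*-Solver
  slack : ∀ n R → n * 2 + (suc n * 3 + R) + 2 ≡ suc n * 5 + R
  slack = solve 2 (λ n R → n :* con 2 :+ ((con 1 :+ n) :* con 3 :+ R) :+ con 2 := (con 1 :+ n) :* con 5 :+ R) refl

serves-roundRobin : ∀ M D b bs →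
                    Serves (roundStart M D b bs) (roundRobin (suc M) (map keysFrom (b ∷ bs)))
                           (suc M * (suc (length bs) * 5))
serves-roundRobin zero D b bs =
  serves-mono (≤-trans (+-monoʳ-≤ (length bs * 2) (s≤s z≤n)) (round-cost (length bs) 0))
    (subst (λ xs → Serves (roundStart zero D b bs) xs (length bs * 2 + 1))
           (cong (_++ []) (map-∘ (b ∷ bs)))
      (serves-rotations zero D b bs (serves-lastKey zero D b bs)))
serves-roundRobin (suc M) D b bs =
  serves-mono cost
    (subst (λ xs → Serves (roundStart (suc M) D b bs) xs roundCost)
           (cong₂ _++_ (map-∘ (b ∷ bs)) (cong (roundRobin (suc M)) (map-keysFrom-shift (b ∷ bs))))
      (serves-rotations (suc M) D b bs (serves-transition M D b bs
        (serves-roundRobin M (node D (current b) leaf) (advance b bs) (shift bs)))))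
  where
  roundCost = length bs * 2 + (suc (length bs) * 3 + suc M * (suc (length (shift bs)) * 5))
  cost : roundCost ≤ suc (suc M) * (suc (length bs) * 5)
  cost rewrite length-shift bs = round-cost (length bs) _

fresh : (ℕ → ℕ) → Block
fresh c = block c nothing

inorder-rightPath : ∀ h m → inorder (rightPath h m) ≡ applyUpTo h m
inorder-rightPath h zero    = refl
inorder-rightPath h (suc m) = cong (h 0 ∷_) (inorder-rightPath (h ∘ suc) m)

inorder-roundStart-fresh : ∀ M c cs →
                           inorder (roundStart M leaf (fresh c) (map fresh cs))
                             ≡ concatMap (λ c′ → applyUpTo c′ (suc M)) (c ∷ cs)
inorder-roundStart-fresh M c cs = cong (c 0 ∷_) (chain-fresh c cs)
  where
  chain-fresh : ∀ c cs → inorder (chain (remainder M (fresh c)) (links M (map fresh cs)))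
                           ≡ applyUpTo (c ∘ suc) M ++ concatMap (λ c′ → applyUpTo c′ (suc M)) cs
  chain-fresh c []        = trans (inorder-rightPath (c ∘ suc) M) (sym (++-identityʳ _))
  chain-fresh c (c′ ∷ cs) =
    cong₂ (λ xs ys → xs ++ c′ 0 ∷ ys) (inorder-rightPath (c ∘ suc) M) (chain-fresh c′ cs)

serves-roundRobin-fresh : ∀ M c cs →
                          Serves (roundStart M leaf (fresh c) (map fresh cs)) (roundRobin (suc M) (c ∷ cs))
                                 (suc M * (suc (length cs) * 5))
serves-roundRobin-fresh M c cs =
  subst₂ (λ cs′ n → Serves t₀ (roundRobin (suc M) (c ∷ cs′)) (suc M * (suc n * 5)))
         (trans (sym (map-∘ cs)) (map-id cs)) (length-map fresh cs)
         (serves-roundRobin M leaf (fresh c) (map fresh cs))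
  where t₀ = roundStart M leaf (fresh c) (map fresh cs)

concatMap-blockKey : ∀ ℓ → concatMap (λ c → applyUpTo c ℓ) (applyUpTo (blockKey ℓ) ℓ) ≡ keys (ℓ * ℓ)
concatMap-blockKey ℓ = begin
  concat (map (λ c → applyUpTo c ℓ) (applyUpTo (blockKey ℓ) ℓ))
    ≡⟨ cong concat (map-applyUpTo (blockKey ℓ) (λ c → applyUpTo c ℓ) ℓ) ⟩
  concat (applyUpTo (λ k → applyUpTo (blockKey ℓ k) ℓ) ℓ)
    ≡⟨ applyUpTo-* suc ℓ ℓ ⟨
  applyUpTo suc (ℓ * ℓ)
    ≡⟨ map-applyUpTo (λ i → i) suc (ℓ * ℓ) ⟨
  keys (ℓ * ℓ) ∎
  where open ≡-Reasoning

mainTheorem5 : ∃[ c ] ((ℓ : ℕ) → 1 ≤ ℓ → OPT≤ (ℓ * ℓ) (tiltedGrid ℓ) (c * (ℓ * ℓ)))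
mainTheorem5 = 5 , λ { (suc ℓ′) _ → optimal ℓ′ }
  where
  optimal : ∀ ℓ′ → let ℓ = suc ℓ′ in OPT≤ (ℓ * ℓ) (tiltedGrid ℓ) (5 * (ℓ * ℓ))
  optimal ℓ′ = t₀ , trans (inorder-roundStart-fresh ℓ′ c₀ cs) (concatMap-blockKey ℓ)
             , subst₂ (Serves t₀) (roundRobin-blockKey ℓ) cost (serves-roundRobin-fresh ℓ′ c₀ cs)
    where
    ℓ  = suc ℓ′
    c₀ = blockKey ℓ 0
    cs = applyUpTo (blockKey ℓ ∘ suc) ℓ′
    t₀ = roundStart ℓ′ leaf (fresh c₀) (map fresh cs)
    cost : ℓ * (suc (length cs) * 5) ≡ 5 * (ℓ * ℓ)
    cost = trans (cong (λ n → ℓ * (suc n * 5)) (length-applyUpTo _ ℓ′))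
                 (trans (sym (*-assoc ℓ ℓ 5)) (*-comm (ℓ * ℓ) 5))
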